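{- For all integers $k,l\ge 2$ there is an ACB graph $G=(X,Y,E)$ with $\nabla_G(X)=k$ and $\nabla_G(Y)=l$.
   Context: For a bipartite graph $B=(X,Y,E)$ with color classes $X,Y$: the mirror $mir(B)$ has the same color classes and $xy$ ($x\in X$, $y\in Y$) is an edge iff it is not an edge of $B$; $B$ is chordal bipartite if it has no induced chordless cycle $C_{2k}$, $k\ge3$; $B$ is ACB if both $B$ and $mir(B)$ are chordal bipartite. $\nabla_B(X)$ is the maximum number of vertices of $X$ whose neighborhoods are pairwise incomparable under set inclusion (equal neighborhoods count as comparable); $\nabla_B(Y)$ analogously. -}

module Defs where

open import Data.Nat using (ℕ; suc; _≤_; _≥_)
open import Data.Fin using (Fin; toℕ)
open import Data.Bool using (Bool; true; false; not)
open import Data.Product using (Σ; _×_; ∃-syntax)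
open import Data.Sum using (_⊎_)
open import Relation.Binary.PropositionalEquality using (_≡_; _≢_)
open import Relation.Nullary using (¬_)
open import Function.Definitions using (Injective)

record BipGraph : Set where
  field
    m : ℕ
    n : ℕ
    E : Fin m → Fin n → Bool
open BipGraph public

mir : BipGraph → BipGraph
mir B = record { m = m B ; n = n B ; E = λ x y → not (E B x y) }

-- Adjacency pattern of the cycle x₀ y₀ x₁ y₁ … x_{k-1} y_{k-1} x₀ :
-- x_j is adjacent to y_i iff j = i or j = i + 1 (mod k).
CycAdj : (k : ℕ) → Fin k → Fin k → Set
CycAdj k j i = (toℕ j ≡ toℕ i) ⊎ (toℕ j ≡ suc (toℕ i)) ⊎ ((suc (toℕ i) ≡ k) × (toℕ j ≡ 0))

-- B contains an induced chordless cycle C_{2k}: distinct x₀,…,x_{k-1} ∈ X and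
-- distinct y₀,…,y_{k-1} ∈ Y such that (among these vertices) x_j y_i is an edge
-- exactly when it is a cycle edge.  (Edges inside X or inside Y never exist.)
InducedCycle : (B : BipGraph) (k : ℕ) → Set
InducedCycle B k =
  Σ (Fin k → Fin (m B)) λ xs → Σ (Fin k → Fin (n B)) λ ys →
    Injective _≡_ _≡_ xs × Injective _≡_ _≡_ ys ×
    (∀ j i → (E B (xs j) (ys i) ≡ true → CycAdj k j i) × (CycAdj k j i → E B (xs j) (ys i) ≡ true))

ChordalBipartite : BipGraph → Set
ChordalBipartite B = ∀ k → k ≥ 3 → ¬ InducedCycle B k

ACB : BipGraph → Set
ACB B = ChordalBipartite B × ChordalBipartite (mir B)


NX⊆ : (B : BipGraph) → Fin (m B) → Fin (m B) → Set
NX⊆ B x x' = ∀ y → E B x y ≡ true → E B x' y ≡ true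

NY⊆ : (B : BipGraph) → Fin (n B) → Fin (n B) → Set
NY⊆ B y y' = ∀ x → E B x y ≡ true → E B x y' ≡ true

AntichainX : (B : BipGraph) (j : ℕ) → Set
AntichainX B j = Σ (Fin j → Fin (m B)) λ f → Injective _≡_ _≡_ f ×
  (∀ a b → a ≢ b → ¬ NX⊆ B (f a) (f b))

AntichainY : (B : BipGraph) (j : ℕ) → Set
AntichainY B j = Σ (Fin j → Fin (n B)) λ f → Injective _≡_ _≡_ f ×
  (∀ a b → a ≢ b → ¬ NY⊆ B (f a) (f b))

∇X≡ : BipGraph → ℕ → Set
∇X≡ B k = AntichainX B k × (∀ j → AntichainX B j → j ≤ k)

∇Y≡ : BipGraph → ℕ → Set
∇Y≡ B k = AntichainY B k × (∀ j → AntichainY B j → j ≤ k)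

-- Each colour class consists of two chains (the up and down vertices, ordered
-- by inclusion of neighbourhoods) and a core, every chain vertex being comparable
-- with every core vertex.  Core vertex x_i of X sees up_j iff j ≤ i and down_j
-- iff i ≤ j, so the k core vertices of X are pairwise incomparable; dually for
-- the l core vertices of Y.  Gluing the two chains to two core vertices covers X
-- by k chains, so ∇(X) = k, and likewise ∇(Y) = l.  In an induced cycle of
-- length at least 6, three consecutive vertices on either side are pairwise
-- incomparable, hence lie in the cores; but every core vertex of X sees all of
-- the core of Y, whereas on the cycle x₀ sees y₀ and not y₁.  Complementation
-- reverses neighbourhood inclusion and turns "sees all" into "sees none", so
-- the same argument applies to the mirror.

module Submission where

open import Defs
open import Data.Bool using (Bool; true; false; not)
open import Data.Bool.Properties using (¬-not)
open import Data.Empty using (⊥; ⊥-elim)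
open import Data.Fin using (Fin; fromℕ; _≤_; _<_)
open import Data.Fin.Patterns using (0F; 1F; 2F; 3F)
open import Data.Fin.Properties
  using (_≟_; _≤?_; ≤-refl; ≤-trans; ≤-total; <-cmp; +↔⊎; toℕ-fromℕ; injective⇒≤)
open import Data.Nat using (ℕ; zero; suc; _+_; _≥_; s≤s)
import Data.Nat as ℕ
open import Data.Nat.Properties using (<⇒≱)
open import Data.Product using (Σ; ∃; _×_; _,_; proj₁; proj₂)
open import Data.Sum using (_⊎_; inj₁; inj₂; [_,_]; swap)
import Data.Sum as Sum
open import Data.Sum.Function.Propositional using (_⊎-↔_)
open import Function using (_∘_; flip; _↔_; Inverse)
open import Function.Definitions using (Injective)
open import Function.Properties.Inverse using (↔-refl; ↔-trans)
open import Relation.Binary using (tri<; tri≈; tri>)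
open import Relation.Binary.PropositionalEquality
  using (_≡_; _≢_; refl; sym; trans; cong; cong₂; subst; module ≡-Reasoning)
open import Relation.Nullary using (¬_; Dec; yes; no; does; contradiction)
open import Relation.Nullary.Decidable using (dec-true; dec-false)

open Inverse using (to; from; strictlyInverseˡ)

-- Antichains and chain covers

module _ {A : Set} (R : A → A → Set) where

  Comparable : A → A → Set
  Comparable a b = R a b ⊎ R b a

  Incomparable : A → A → Set
  Incomparable a b = ¬ Comparable a b

  Incomparable₃ : A → A → A → Set
  Incomparable₃ a b c = Incomparable a b × Incomparable a c × Incomparable b c

  IsAntichain : {j : ℕ} → (Fin j → A) → Set
  IsAntichain f = ∀ a b → a ≢ b → ¬ R (f a) (f b)

  IsChainCover : {c : ℕ} → (A → Fin c) → Set
  IsChainCover tag = ∀ u v → tag u ≡ tag v → Comparable u v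

module _ {A : Set} {R : A → A → Set} where

  incomparable-sym : ∀ {a b} → Incomparable R a b → Incomparable R b a
  incomparable-sym a∥b = a∥b ∘ swap

  antichain⇒injective : (∀ {a} → R a a) → ∀ {j} {f : Fin j → A} →
                        IsAntichain R f → Injective _≡_ _≡_ f
  antichain⇒injective R-refl {f = f} anti {a} {b} fa≡fb with a ≟ b
  ... | yes a≡b = a≡b
  ... | no  a≢b = contradiction (subst (R (f a)) fa≡fb R-refl) (anti a b a≢b)

  -- Each chain of the cover meets an antichain at most once.
  antichain-size≤cover : ∀ {c} (tag : A → Fin c) → IsChainCover R tag →
                         ∀ {j} (f : Fin j → A) → IsAntichain R f → j ℕ.≤ c
  antichain-size≤cover tag cover f anti = injective⇒≤ tag∘f-injective
    where
    tag∘f-injective : Injective _≡_ _≡_ (tag ∘ f)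
    tag∘f-injective {a} {b} eq with a ≟ b
    ... | yes a≡b = a≡b
    ... | no  a≢b = ⊥-elim ([ anti a b a≢b , anti b a (a≢b ∘ sym) ] (cover (f a) (f b) eq))

  chain-of-monotone : ∀ {n} (f : Fin n → A) → (∀ {i j} → i ≤ j → R (f i) (f j)) →
                      ∀ i j → Comparable R (f i) (f j)
  chain-of-monotone _ mono i j = Sum.map mono mono (≤-total i j)

  chain-of-antitone : ∀ {n} (f : Fin n → A) → (∀ {i j} → i ≤ j → R (f j) (f i)) →
                      ∀ i j → Comparable R (f i) (f j)
  chain-of-antitone _ anti i j = Sum.map anti anti (≤-total j i)

pattern up   i = inj₁ i
pattern down i = inj₂ (inj₁ i)
pattern core i = inj₂ (inj₂ i)

record ChainSplit {A B C : Set} (R : A ⊎ B ⊎ C → A ⊎ B ⊎ C → Set) : Set where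
  field
    up-chain     : ∀ a a′ → Comparable R (up a) (up a′)
    down-chain   : ∀ b b′ → Comparable R (down b) (down b′)
    up-vs-core   : ∀ a c → Comparable R (up a) (core c)
    down-vs-core : ∀ b c → Comparable R (down b) (core c)

module _ {A B C : Set} {R : A ⊎ B ⊎ C → A ⊎ B ⊎ C → Set} (S : ChainSplit R) where
  open ChainSplit S

  private
    partner-of-up : ∀ {a v} → Incomparable R (up a) v → ∃ λ b → v ≡ down b
    partner-of-up {a} {up a′}  a∥v = ⊥-elim (a∥v (up-chain a a′))
    partner-of-up {v = down b} _   = b , refl
    partner-of-up {a} {core c} a∥v = ⊥-elim (a∥v (up-vs-core a c))

    partner-of-down : ∀ {b v} → Incomparable R (down b) v → ∃ λ a → v ≡ up a
    partner-of-down {v = up a}    _   = a , refl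
    partner-of-down {b} {down b′} b∥v = ⊥-elim (b∥v (down-chain b b′))
    partner-of-down {b} {core c}  b∥v = ⊥-elim (b∥v (down-vs-core b c))

  -- An up vertex is incomparable only with down vertices and vice versa,
  -- so a triangle of incomparable vertices lies in the core.
  incomparable₃⇒core : ∀ {u v w} → Incomparable₃ R u v w → ∃ λ c → u ≡ core c
  incomparable₃⇒core {up _} (u∥v , u∥w , v∥w)
    with partner-of-up u∥v | partner-of-up u∥w
  ... | b , refl | b′ , refl = ⊥-elim (v∥w (down-chain b b′))
  incomparable₃⇒core {down _} (u∥v , u∥w , v∥w)
    with partner-of-down u∥v | partner-of-down u∥w
  ... | a , refl | a′ , refl = ⊥-elim (v∥w (up-chain a a′))
  incomparable₃⇒core {core c} _ = c , refl

splitTag : ∀ {A B : Set} {n} → Fin n → Fin n → A ⊎ B ⊎ Fin n → Fin n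
splitTag z o (up _)   = z
splitTag z o (down _) = o
splitTag z o (core c) = c

module _ {A B : Set} {n : ℕ} {R : A ⊎ B ⊎ Fin n → A ⊎ B ⊎ Fin n → Set} where

  split-chainCover : ChainSplit R → (∀ {x} → R x x) → ∀ {z o} → z ≢ o →
                     IsChainCover R (splitTag z o)
  split-chainCover S R-refl z≢o = cover
    where
    open ChainSplit S
    cover : ∀ u v → splitTag _ _ u ≡ splitTag _ _ v → Comparable R u v
    cover (up a)   (up a′)   _    = up-chain a a′
    cover (up _)   (down _)  z≡o  = ⊥-elim (z≢o z≡o)
    cover (up a)   (core c)  _    = up-vs-core a c
    cover (down _) (up _)    o≡z  = ⊥-elim (z≢o (sym o≡z))
    cover (down b) (down b′) _    = down-chain b b′
    cover (down b) (core c)  _    = down-vs-core b c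
    cover (core c) (up a)    _    = swap (up-vs-core a c)
    cover (core c) (down b)  _    = swap (down-vs-core b c)
    cover (core c) (core _)  refl = inj₁ R-refl

-- Neighbourhoods and induced cycles

N⊆ : {X Y : Set} → (X → Y → Bool) → X → X → Set
N⊆ R u u′ = ∀ v → R u v ≡ true → R u′ v ≡ true

mirror : {X Y : Set} → (X → Y → Bool) → X → Y → Bool
mirror R u v = not (R u v)

module _ {X Y : Set} {R : X → Y → Bool} where

  separated⇒⊈ : ∀ {u u′ v} → R u v ≡ true → R u′ v ≡ false → ¬ N⊆ R u u′
  separated⇒⊈ {v = v} uv u′v sub with () ← trans (sym (sub v uv)) u′v

  separated⇒incomparable : ∀ {u u′ v v′} →
    R u v ≡ true → R u′ v ≡ false → R u′ v′ ≡ true → R u v′ ≡ false →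
    Incomparable (N⊆ R) u u′
  separated⇒incomparable uv u′v u′v′ uv′ =
    [ separated⇒⊈ uv u′v , separated⇒⊈ u′v′ uv′ ]

  N⊆-mirror : ∀ {u u′} → N⊆ R u u′ → N⊆ (mirror R) u′ u
  N⊆-mirror {u} {u′} sub v u′v with R u v in uv
  ... | false = refl
  ... | true  with () ← trans (sym (cong not (sub v uv))) u′v

  comparable-mirror : ∀ {u u′} → Comparable (N⊆ R) u u′ → Comparable (N⊆ (mirror R)) u u′
  comparable-mirror = swap ∘ Sum.map N⊆-mirror N⊆-mirror

CycleIn : {X Y : Set} → (X → Y → Bool) → ℕ → Set
CycleIn {X} {Y} R K = Σ (Fin K → X) λ xs → Σ (Fin K → Y) λ ys →
  ∀ j i → (R (xs j) (ys i) ≡ true → CycAdj K j i) × (CycAdj K j i → R (xs j) (ys i) ≡ true)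

record CycleCore {X Y : Set} (R : X → Y → Bool) : Set where
  field
    u₀ u₁ u₂ : X
    v₀ v₁ v₂ : Y
    us-incomparable : Incomparable₃ (N⊆ R) u₀ u₁ u₂
    vs-incomparable : Incomparable₃ (N⊆ (flip R)) v₀ v₁ v₂
    u₀v₀ : R u₀ v₀ ≡ true
    u₀v₁ : R u₀ v₁ ≡ false

-- x₃, or x₀ when the cycle is a hexagon
y₂-other-neighbour : ∀ K → Σ (Fin (3 + K)) λ w → CycAdj (3 + K) w 2F × ¬ CycAdj (3 + K) w 1F
y₂-other-neighbour zero    = 0F , inj₂ (inj₂ (refl , refl)) ,
  λ { (inj₁ ()) ; (inj₂ (inj₁ ())) ; (inj₂ (inj₂ (() , _))) }
y₂-other-neighbour (suc K) = 3F , inj₂ (inj₁ refl) ,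
  λ { (inj₁ ()) ; (inj₂ (inj₁ ())) ; (inj₂ (inj₂ (() , _))) }

cycle⇒core : ∀ {X Y} {R : X → Y → Bool} {K} → 3 ℕ.≤ K → CycleIn R K → CycleCore R
cycle⇒core {R = R} {K = suc (suc (suc K))} (s≤s (s≤s (s≤s _))) (xs , ys , cyc) = record
  { u₀ = xs 0F ; u₁ = xs 1F ; u₂ = xs 2F
  ; v₀ = ys 0F ; v₁ = ys 1F ; v₂ = ys 2F
  ; us-incomparable = separated⇒incomparable {R = R} x₀yₗ x₁yₗ x₁y₁ x₀y₁
                    , separated⇒incomparable {R = R} x₀y₀ x₂y₀ x₂y₁ x₀y₁
                    , separated⇒incomparable {R = R} x₁y₀ x₂y₀ x₂y₂ x₁y₂
  ; vs-incomparable = separated⇒incomparable {R = flip R} x₀y₀ x₀y₁ x₂y₁ x₂y₀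
                    , separated⇒incomparable {R = flip R} x₁y₀ x₁y₂ x₂y₂ x₂y₀
                    , separated⇒incomparable {R = flip R} x₁y₁ x₁y₂ x_wy₂ x_wy₁
  ; u₀v₀ = x₀y₀
  ; u₀v₁ = x₀y₁
  }
  where
  _~_ _≁_ : Fin (3 + K) → Fin (3 + K) → Set
  j ~ i = R (xs j) (ys i) ≡ true
  j ≁ i = R (xs j) (ys i) ≡ false

  edge : ∀ {j i} → CycAdj (3 + K) j i → j ~ i
  edge {j} {i} = proj₂ (cyc j i)

  non-edge : ∀ {j i} → ¬ CycAdj (3 + K) j i → j ≁ i
  non-edge {j} {i} j≁i = ¬-not (j≁i ∘ proj₁ (cyc j i))

  last w : Fin (3 + K)
  last = fromℕ (2 + K)
  w = proj₁ (y₂-other-neighbour K)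

  x₀y₀ : 0F ~ 0F
  x₀y₀ = edge (inj₁ refl)
  x₁y₀ : 1F ~ 0F
  x₁y₀ = edge (inj₂ (inj₁ refl))
  x₁y₁ : 1F ~ 1F
  x₁y₁ = edge (inj₁ refl)
  x₂y₁ : 2F ~ 1F
  x₂y₁ = edge (inj₂ (inj₁ refl))
  x₂y₂ : 2F ~ 2F
  x₂y₂ = edge (inj₁ refl)
  x₀yₗ : 0F ~ last
  x₀yₗ = edge (inj₂ (inj₂ (cong suc (toℕ-fromℕ (2 + K)) , refl)))
  x_wy₂ : w ~ 2F
  x_wy₂ = edge (proj₁ (proj₂ (y₂-other-neighbour K)))

  x₀y₁ : 0F ≁ 1F
  x₀y₁ = non-edge λ { (inj₁ ()) ; (inj₂ (inj₁ ())) ; (inj₂ (inj₂ (() , _))) }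
  x₁y₂ : 1F ≁ 2F
  x₁y₂ = non-edge λ { (inj₁ ()) ; (inj₂ (inj₁ ())) ; (inj₂ (inj₂ (_ , ()))) }
  x₂y₀ : 2F ≁ 0F
  x₂y₀ = non-edge λ { (inj₁ ()) ; (inj₂ (inj₁ ())) ; (inj₂ (inj₂ (() , _))) }
  x₁yₗ : 1F ≁ last
  x₁yₗ = non-edge λ { (inj₁ ()) ; (inj₂ (inj₁ ())) ; (inj₂ (inj₂ (_ , ()))) }
  x_wy₁ : w ≁ 1F
  x_wy₁ = non-edge (proj₂ (proj₂ (y₂-other-neighbour K)))

record ChainSplitGraph {A B C A′ B′ C′ : Set}
                       (R : A ⊎ B ⊎ C → A′ ⊎ B′ ⊎ C′ → Bool) : Set where
  field
    left-split   : ChainSplit (N⊆ R)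
    right-split  : ChainSplit (N⊆ (flip R))
    core-uniform : ∀ c c′ c″ → R (core c) (core c′) ≡ R (core c) (core c″)

chainSplit-mirror : ∀ {A B C Y : Set} {S : A ⊎ B ⊎ C → Y → Bool} →
                    ChainSplit (N⊆ S) → ChainSplit (N⊆ (mirror S))
chainSplit-mirror {S = S} split = record
  { up-chain     = λ a a′ → comparable-mirror {R = S} (up-chain a a′)
  ; down-chain   = λ b b′ → comparable-mirror {R = S} (down-chain b b′)
  ; up-vs-core   = λ a c → comparable-mirror {R = S} (up-vs-core a c)
  ; down-vs-core = λ b c → comparable-mirror {R = S} (down-vs-core b c)
  }
  where open ChainSplit split

module _ {A B C A′ B′ C′ : Set} {R : A ⊎ B ⊎ C → A′ ⊎ B′ ⊎ C′ → Bool} where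

  chainSplitGraph-mirror : ChainSplitGraph R → ChainSplitGraph (mirror R)
  chainSplitGraph-mirror G = record
    { left-split   = chainSplit-mirror left-split
    ; right-split  = chainSplit-mirror right-split
    ; core-uniform = λ c c′ c″ → cong not (core-uniform c c′ c″)
    }
    where open ChainSplitGraph G

  chainSplitGraph⇒¬core : ChainSplitGraph R → ¬ CycleCore R
  chainSplitGraph⇒¬core G C =
    cores-indistinguishable (incomparable₃⇒core left-split us-incomparable)
                            (incomparable₃⇒core right-split vs-incomparable)
                            (incomparable₃⇒core right-split v₁-triangle)
    where
    open ChainSplitGraph G
    open CycleCore C
    open ≡-Reasoning
    v₀∥v₁ : Incomparable (N⊆ (flip R)) v₀ v₁
    v₀∥v₁ = proj₁ vs-incomparable
    v₀∥v₂ : Incomparable (N⊆ (flip R)) v₀ v₂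
    v₀∥v₂ = proj₁ (proj₂ vs-incomparable)
    v₁∥v₂ : Incomparable (N⊆ (flip R)) v₁ v₂
    v₁∥v₂ = proj₂ (proj₂ vs-incomparable)
    v₁-triangle : Incomparable₃ (N⊆ (flip R)) v₁ v₀ v₂
    v₁-triangle = incomparable-sym {R = N⊆ (flip R)} v₀∥v₁ , v₁∥v₂ , v₀∥v₂

    cores-indistinguishable : ∃ (λ c → u₀ ≡ core c) → ∃ (λ c → v₀ ≡ core c) →
                              ∃ (λ c → v₁ ≡ core c) → ⊥
    cores-indistinguishable (c , u₀≡c) (c′ , v₀≡c′) (c″ , v₁≡c″) = contradiction (begin
      true                 ≡⟨ sym u₀v₀ ⟩
      R u₀ v₀              ≡⟨ cong₂ R u₀≡c v₀≡c′ ⟩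
      R (core c) (core c′) ≡⟨ core-uniform c c′ c″ ⟩
      R (core c) (core c″) ≡⟨ cong₂ R u₀≡c v₁≡c″ ⟨
      R u₀ v₁              ≡⟨ u₀v₁ ⟩
      false                ∎) λ ()

  chainSplitGraph⇒no-long-cycle : ChainSplitGraph R → ∀ K → 3 ℕ.≤ K → ¬ CycleIn R K
  chainSplitGraph⇒no-long-cycle G K K≥3 = chainSplitGraph⇒¬core G ∘ cycle⇒core K≥3

-- Bipartite graphs coded by Fin

codedGraph : ∀ {m n} {X Y : Set} → Fin m ↔ X → Fin n ↔ Y → (X → Y → Bool) → BipGraph
codedGraph {m} {n} cˣ cʸ R = record { m = m ; n = n ; E = λ x y → R (to cˣ x) (to cʸ y) }

module _ {m n} {X Y : Set} (cˣ : Fin m ↔ X) (cʸ : Fin n ↔ Y) {R : X → Y → Bool} where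

  private
    G : BipGraph
    G = codedGraph cˣ cʸ R

  coded-chordal : (∀ K → 3 ℕ.≤ K → ¬ CycleIn R K) → ChordalBipartite G
  coded-chordal no-cycle K K≥3 (xs , ys , _ , _ , cyc) =
    no-cycle K K≥3 (to cˣ ∘ xs , to cʸ ∘ ys , cyc)

  coded-∇X : ∀ {k} (f : Fin k → X) → IsAntichain (N⊆ R) f →
             (∀ {j} (g : Fin j → X) → IsAntichain (N⊆ R) g → j ℕ.≤ k) → ∇X≡ G k
  coded-∇X f anti bound =
      (from cˣ ∘ f , antichain⇒injective {R = NX⊆ G} (λ _ uv → uv) coded-anti , coded-anti)
    , λ _ (g , _ , anti) → bound (to cˣ ∘ g) λ a b a≢b sub → anti a b a≢b (sub ∘ to cʸ)
    where
    R-to-from : ∀ u v → R (to cˣ (from cˣ u)) (to cʸ (from cʸ v)) ≡ R u v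
    R-to-from u v = cong₂ R (strictlyInverseˡ cˣ u) (strictlyInverseˡ cʸ v)

    coded-anti : IsAntichain (NX⊆ G) (from cˣ ∘ f)
    coded-anti a b a≢b sub = anti a b a≢b λ v fa~v →
      trans (sym (R-to-from (f b) v)) (sub (from cʸ v) (trans (R-to-from (f a) v) fa~v))

module _ {A B C A′ B′ C′ : Set} {m n}
         (cˣ : Fin m ↔ (A ⊎ B ⊎ C)) (cʸ : Fin n ↔ (A′ ⊎ B′ ⊎ C′))
         {R : A ⊎ B ⊎ C → A′ ⊎ B′ ⊎ C′ → Bool} where

  chainSplitGraph⇒ACB : ChainSplitGraph R → ACB (codedGraph cˣ cʸ R)
  chainSplitGraph⇒ACB G =
      coded-chordal cˣ cʸ {R = R} (chainSplitGraph⇒no-long-cycle G)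
    , coded-chordal cˣ cʸ {R = mirror R}
        (chainSplitGraph⇒no-long-cycle (chainSplitGraph-mirror G))

chainSplit⇒∇X : ∀ {A B Y : Set} {m m′ n} →
                (cˣ : Fin m ↔ (A ⊎ B ⊎ Fin (2 + n))) (cʸ : Fin m′ ↔ Y) →
                {R : A ⊎ B ⊎ Fin (2 + n) → Y → Bool} →
                ChainSplit (N⊆ R) → IsAntichain (N⊆ R) (λ c → core c) →
                ∇X≡ (codedGraph cˣ cʸ R) (2 + n)
chainSplit⇒∇X cˣ cʸ {R} split cores-antichain =
  coded-∇X cˣ cʸ {R = R} (λ c → core c) cores-antichain
    (antichain-size≤cover (splitTag 0F 1F) (split-chainCover split (λ _ uv → uv) λ ()))

-- The construction

from-does-true : ∀ {P : Set} (p? : Dec P) → does p? ≡ true → P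
from-does-true (yes p) _ = p

module _ {n : ℕ} {i j q : Fin n} (i≤j : i ≤ j) where

  ≤?-upward : does (j ≤? q) ≡ true → does (i ≤? q) ≡ true
  ≤?-upward j≤q = dec-true (i ≤? q) (≤-trans i≤j (from-does-true (j ≤? q) j≤q))

  ≤?-downward : does (q ≤? i) ≡ true → does (q ≤? j) ≡ true
  ≤?-downward q≤i = dec-true (q ≤? j) (≤-trans (from-does-true (q ≤? i) q≤i) i≤j)

≤?-refl : ∀ {n} (a : Fin n) → does (a ≤? a) ≡ true
≤?-refl a = dec-true (a ≤? a) ≤-refl

≤?-false : ∀ {n} {a b : Fin n} → a < b → does (b ≤? a) ≡ false
≤?-false {a = a} {b} a<b = dec-false (b ≤? a) (<⇒≱ a<b)

V : ℕ → ℕ → Set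
V p q = Fin p ⊎ Fin p ⊎ Fin q

V-coding : ∀ p q → Fin (p + (p + q)) ↔ V p q
V-coding p q = ↔-trans +↔⊎ (↔-refl ⊎-↔ +↔⊎)

module HalfGraphs (k l : ℕ) where

  edge : V l k → V k l → Bool
  edge (core i) (up j)   = does (j ≤? i)
  edge (core i) (down j) = does (i ≤? j)
  edge (core _) (core _) = true
  edge (up i)   (core j) = does (i ≤? j)
  edge (down i) (core j) = does (j ≤? i)
  edge _        _        = false

  edge-chainSplitGraph : ChainSplitGraph edge
  edge-chainSplitGraph = record
    { left-split = record
      { up-chain     = chain-of-antitone {R = N⊆ edge} (λ i → up i) λ i≤j →
                         λ { (core q) → ≤?-upward {q = q} i≤j ; (up _) () ; (down _) () }
      ; down-chain   = chain-of-monotone {R = N⊆ edge} (λ i → down i) λ i≤j →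
                         λ { (core q) → ≤?-downward {q = q} i≤j ; (up _) () ; (down _) () }
      ; up-vs-core   = λ _ _ → inj₁ λ { (core _) _ → refl ; (up _) () ; (down _) () }
      ; down-vs-core = λ _ _ → inj₁ λ { (core _) _ → refl ; (up _) () ; (down _) () }
      }
    ; right-split = record
      { up-chain     = chain-of-antitone {R = N⊆ (flip edge)} (λ i → up i) λ i≤j →
                         λ { (core q) → ≤?-upward {q = q} i≤j ; (up _) () ; (down _) () }
      ; down-chain   = chain-of-monotone {R = N⊆ (flip edge)} (λ i → down i) λ i≤j →
                         λ { (core q) → ≤?-downward {q = q} i≤j ; (up _) () ; (down _) () }
      ; up-vs-core   = λ _ _ → inj₁ λ { (core _) _ → refl ; (up _) () ; (down _) () }
      ; down-vs-core = λ _ _ → inj₁ λ { (core _) _ → refl ; (up _) () ; (down _) () }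
      }
    ; core-uniform = λ _ _ _ → refl
    }

  left-cores-antichain : IsAntichain (N⊆ edge) (λ (i : Fin k) → core i)
  left-cores-antichain a b a≢b with <-cmp a b
  ... | tri< a<b _ _ =
      separated⇒⊈ {R = edge} {core a} {core b} {down a} (≤?-refl a) (≤?-false a<b)
  ... | tri≈ _ a≡b _ = contradiction a≡b a≢b
  ... | tri> _ _ b<a =
      separated⇒⊈ {R = edge} {core a} {core b} {up a} (≤?-refl a) (≤?-false b<a)

  right-cores-antichain : IsAntichain (N⊆ (flip edge)) (λ (j : Fin l) → core j)
  right-cores-antichain a b a≢b with <-cmp a b
  ... | tri< a<b _ _ =
      separated⇒⊈ {R = flip edge} {core a} {core b} {down a} (≤?-refl a) (≤?-false a<b)
  ... | tri≈ _ a≡b _ = contradiction a≡b a≢b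
  ... | tri> _ _ b<a =
      separated⇒⊈ {R = flip edge} {core a} {core b} {up a} (≤?-refl a) (≤?-false b<a)

corollary6 : (k l : ℕ) → k ≥ 2 → l ≥ 2 →
    Σ BipGraph λ G → ACB G × ∇X≡ G k × ∇Y≡ G l
corollary6 k l (s≤s (s≤s _)) (s≤s (s≤s _)) =
    codedGraph (V-coding l k) (V-coding k l) edge
  , chainSplitGraph⇒ACB (V-coding l k) (V-coding k l) edge-chainSplitGraph
  , chainSplit⇒∇X (V-coding l k) (V-coding k l) left-split left-cores-antichain
  , chainSplit⇒∇X (V-coding k l) (V-coding l k) right-split right-cores-antichain
  where
  open HalfGraphs k l
  open ChainSplitGraph edge-chainSplitGraph
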